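{- For every integer $n\ge 2$, the automorphism group of the mixed graph $F^*(n)$ is isomorphic to the dihedral group $D_3$ (of order $6$, isomorphic to the symmetric group $S_3$).
   Context: A mixed graph has a vertex set, a set of (undirected) edges and a set of arcs (ordered pairs of vertices). An automorphism is a bijection of the vertex set that maps edges to edges and arcs to arcs (preserving direction), with inverse doing the same. For $n\ge 2$, the mixed graph $F^*(n)$ has vertex set consisting of all labels $a|x_1x_2\ldots x_n$ with $a\in\{+1,-1\}$, $x_i\in\mathbb{Z}_3$, and $x_{i+1}\neq x_i$ for $i=1,\ldots,n-1$. Its edges join $a|x_1x_2\ldots x_n$ and $-a|x_1x_2\ldots x_n$, and its arcs go from $a|x_1x_2\ldots x_n$ to $a|x_2x_3\ldots x_n\,(x_n+a(x_2-x_1))$, where $x_2-x_1$, computed modulo $3$, is regarded as an element of $\{+1,-1\}$ and all arithmetic is in $\mathbb{Z}_3$. -}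

module Defs where

open import Level using (0ℓ)
open import Data.Nat using (ℕ; suc)
open import Data.Fin using (Fin; zero; suc)
open import Data.Fin.Properties using (_≟_)
open import Data.Fin.Permutation using (Permutation′; _∘ₚ_; flip) renaming (id to idₚ; _≈_ to _≈ₚ_)
open import Data.Vec using (Vec; []; _∷_; _∷ʳ_; last)
open import Data.Bool using (T; not)
open import Data.Unit using (⊤)
open import Data.Empty using (⊥)
open import Data.Product using (Σ; _×_; _,_; proj₁; proj₂)
open import Relation.Nullary using (⌊_⌋)
open import Relation.Binary.PropositionalEquality using (_≡_)
open import Algebra.Bundles.Raw using (RawGroup)
open import Function using (_∘_; id)

Z3 : Set
Z3 = Fin 3

_⊕_ : Z3 → Z3 → Z3
zero ⊕ y = y
suc zero ⊕ zero = suc zero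
suc zero ⊕ suc zero = suc (suc zero)
suc zero ⊕ suc (suc zero) = zero
suc (suc zero) ⊕ zero = suc (suc zero)
suc (suc zero) ⊕ suc zero = zero
suc (suc zero) ⊕ suc (suc zero) = suc zero

⊖_ : Z3 → Z3
⊖ zero = zero
⊖ suc zero = suc (suc zero)
⊖ suc (suc zero) = suc zero

_⊝_ : Z3 → Z3 → Z3
x ⊝ y = x ⊕ (⊖ y)

data Sign : Set where
  plus minus : Sign

negS : Sign → Sign
negS plus = minus
negS minus = plus

_·_ : Sign → Z3 → Z3
plus · d = d
minus · d = ⊖ d

Label : ℕ → Set
Label n = Sign × Vec Z3 n

-- x_{i+1} ≠ x_i for all consecutive positions (boolean test, so that
-- proofs of validity are unique)
AdjDistinct : ∀ {n} → Vec Z3 n → Set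
AdjDistinct [] = ⊤
AdjDistinct (x ∷ []) = ⊤
AdjDistinct (x ∷ y ∷ r) = T (not ⌊ x ≟ y ⌋) × AdjDistinct (y ∷ r)

Vertex : ℕ → Set
Vertex n = Σ (Label n) (λ ℓ → AdjDistinct (proj₂ ℓ))

Edge : ∀ {n} → Vertex n → Vertex n → Set
Edge ((a , x) , _) ((b , y) , _) = (b ≡ negS a) × (y ≡ x)

-- Arc relation: a|x₁x₂…xₙ → a|x₂…xₙ (xₙ + a(x₂ − x₁))  (needs n ≥ 2;
-- for n < 2 there are no arcs, which is irrelevant as n ≥ 2 below)
ArcTarget : ∀ {n} → Label n → Label n → Set
ArcTarget (a , []) _ = ⊥
ArcTarget (a , x ∷ []) _ = ⊥
ArcTarget (a , x₁ ∷ x₂ ∷ r) ℓ =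
  ℓ ≡ (a , ((x₂ ∷ r) ∷ʳ (last (x₂ ∷ r) ⊕ (a · (x₂ ⊝ x₁)))))

Arc : ∀ {n} → Vertex n → Vertex n → Set
Arc (ℓ , _) (ℓ′ , _) = ArcTarget ℓ ℓ′

record Aut (n : ℕ) : Set where
  field
    to      : Vertex n → Vertex n
    from    : Vertex n → Vertex n
    from∘to : ∀ v → from (to v) ≡ v
    to∘from : ∀ v → to (from v) ≡ v
    to-edge   : ∀ {u v} → Edge u v → Edge (to u) (to v)
    from-edge : ∀ {u v} → Edge u v → Edge (from u) (from v)
    to-arc    : ∀ {u v} → Arc u v → Arc (to u) (to v)
    from-arc  : ∀ {u v} → Arc u v → Arc (from u) (from v)

open Aut

idAut : ∀ {n} → Aut n
idAut = record
  { to = id ; from = id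
  ; from∘to = λ _ → Relation.Binary.PropositionalEquality.refl
  ; to∘from = λ _ → Relation.Binary.PropositionalEquality.refl
  ; to-edge = id ; from-edge = id ; to-arc = id ; from-arc = id }

_∘A_ : ∀ {n} → Aut n → Aut n → Aut n
f ∘A g = record
  { to = to f ∘ to g
  ; from = from g ∘ from f
  ; from∘to = λ v → trans (cong (from g) (from∘to f (to g v))) (from∘to g v)
  ; to∘from = λ v → trans (cong (to f) (to∘from g (from f v))) (to∘from f v)
  ; to-edge = to-edge f ∘ to-edge g
  ; from-edge = from-edge g ∘ from-edge f
  ; to-arc = to-arc f ∘ to-arc g
  ; from-arc = from-arc g ∘ from-arc f }
  where open Relation.Binary.PropositionalEquality using (trans; cong)

invAut : ∀ {n} → Aut n → Aut n
invAut f = record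
  { to = from f ; from = to f
  ; from∘to = to∘from f ; to∘from = from∘to f
  ; to-edge = from-edge f ; from-edge = to-edge f
  ; to-arc = from-arc f ; from-arc = to-arc f }

_≈A_ : ∀ {n} → Aut n → Aut n → Set
f ≈A g = ∀ v → to f v ≡ to g v

AutGroup : ℕ → RawGroup 0ℓ 0ℓ
AutGroup n = record
  { Carrier = Aut n ; _≈_ = _≈A_ ; _∙_ = _∘A_ ; ε = idAut ; _⁻¹ = invAut }

-- D₃ ≅ S₃, realised as the symmetric group on Fin 3 (the symmetries
-- of the vertices of a triangle), with ordinary composition
-- (σ ∙ τ)(i) = σ (τ i).

D3 : RawGroup 0ℓ 0ℓ
D3 = record
  { Carrier = Permutation′ 3 ; _≈_ = _≈ₚ_
  ; _∙_ = λ σ τ → τ ∘ₚ σ ; ε = idₚ ; _⁻¹ = flip }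

module Submission where

-- The affine maps x ↦ c ± x of Z₃ form AGL(1, 3) ≅ S₃ ≅ D₃, and they act on
-- F*(n) by relabelling letters, because they commute with the arc rule
-- xₙ + a(x₂ − x₁). The vertex
-- +|012012… lies on a directed triangle, and three arcs returning to a|x force
-- x to be 3-periodic, which by the arc rule forces a = +1 and x to be an
-- arithmetic progression; so f(+|012012…) is the relabelling of +|012012… by
-- some affine map A. Finally an automorphism is determined by the image of one
-- vertex: every vertex has at most one incoming arc and one edge, and every
-- vertex is reached from any other backwards, prepending one letter at a time
-- along an arc into the current vertex or into its edge partner. Hence f is
-- the relabelling by A.

open import Level using (0ℓ)
open import Defs
open import Data.Nat using (ℕ; zero; suc; _+_; _≤_; s≤s; z≤n)
open import Data.Fin using (Fin; toℕ)
open import Data.Fin.Patterns using (0F; 1F; 2F)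
open import Data.Fin.Properties using (_≟_; all?; any?)
open import Data.Fin.Permutation
  using (Permutation′; permutation; _⟨$⟩ʳ_; _⟨$⟩ˡ_; inverseˡ)
open import Data.Vec
  using (Vec; []; _∷_; _∷ʳ_; _++_; head; last; init; initLast; map; lookup)
open import Data.Vec.Properties
  using (∷-injective; ∷ʳ-injective; map-∷ʳ; map-∘; map-cong; map-id; last-∷ʳ; lookup∘tabulate)
  renaming (≡-dec to ≡-decᵛ)
open import Data.Bool using (T; true)
open import Data.Unit using (tt)
open import Data.Product using (Σ; ∃; _×_; _,_; proj₁; proj₂)
open import Data.Product.Properties using () renaming (≡-dec to ≡-decˣ)
open import Data.Sum using (_⊎_; inj₁; inj₂)
open import Function using (_∘_)
open import Relation.Nullary using (Dec; yes; no)
open import Relation.Nullary.Decidable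
  using (True; toWitness; toWitnessFalse; fromWitnessFalse; map′; T?; _×-dec_; _⊎-dec_; _→-dec_; ¬?)
open import Relation.Unary using (Decidable)
open import Relation.Binary.PropositionalEquality
  using (_≡_; _≢_; refl; sym; trans; cong; cong₂; subst; module ≡-Reasoning)
open import Algebra.Bundles.Raw using (RawGroup)
open import Algebra.Morphism.Structures using (module GroupMorphisms)
open import Algebra.Morphism.Construct.Composition using (isGroupIsomorphism)

open Aut

by-exhaustion : ∀ {P : Set} (p? : Dec P) → {True p?} → P
by-exhaustion p? {t} = toWitness t

_≟ˢ_ : (a b : Sign) → Dec (a ≡ b)
plus  ≟ˢ plus  = yes refl
plus  ≟ˢ minus = no λ ()
minus ≟ˢ plus  = no λ ()
minus ≟ˢ minus = yes refl

∀-Sign? : {P : Sign → Set} → Decidable P → Dec (∀ a → P a)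
∀-Sign? P? = map′ (λ (p , m) → λ { plus → p ; minus → m }) (λ h → h plus , h minus)
                  (P? plus ×-dec P? minus)

adjDistinct? : ∀ {n} (x : Vec Z3 n) → Dec (AdjDistinct x)
adjDistinct? []          = yes tt
adjDistinct? (x ∷ [])    = yes tt
adjDistinct? (x ∷ y ∷ r) = T? _ ×-dec adjDistinct? (y ∷ r)

label? : ∀ {n} (ℓ ℓ′ : Label n) → Dec (ℓ ≡ ℓ′)
label? = ≡-decˣ _≟ˢ_ (≡-decᵛ _≟_)

newLetter : Sign → Z3 → Z3 → Z3 → Z3
newLetter a x₁ x₂ xₙ = xₙ ⊕ (a · (x₂ ⊝ x₁))

next : ∀ {m} → Label (suc (suc m)) → Label (suc (suc m))
next (a , x₁ ∷ x₂ ∷ r) = a , (x₂ ∷ r) ∷ʳ newLetter a x₁ x₂ (last (x₂ ∷ r))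

newLetter-injective : ∀ a x₁ y₁ x₂ xₙ →
  newLetter a x₁ x₂ xₙ ≡ newLetter a y₁ x₂ xₙ → x₁ ≡ y₁
newLetter-injective = by-exhaustion
  (∀-Sign? λ a → all? λ x₁ → all? λ y₁ → all? λ x₂ → all? λ xₙ → (_ ≟ _) →-dec (x₁ ≟ y₁))

newLetter-either : ∀ a x₁ x₂ xₙ t → x₁ ≢ x₂ → t ≢ xₙ →
  t ≡ newLetter a x₁ x₂ xₙ ⊎ t ≡ newLetter (negS a) x₁ x₂ xₙ
newLetter-either = by-exhaustion
  (∀-Sign? λ a → all? λ x₁ → all? λ x₂ → all? λ xₙ → all? λ t →
    ¬? (x₁ ≟ x₂) →-dec ¬? (t ≟ xₙ) →-dec ((t ≟ _) ⊎-dec (t ≟ _)))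

-- The affine group AGL(1, 3)

record Aff : Set where
  constructor aff
  field
    shift : Z3
    sign  : Sign

open Aff

app : Aff → Z3 → Z3
app (aff c e) x = c ⊕ (e · x)

_*ˢ_ : Sign → Sign → Sign
plus  *ˢ e = e
minus *ˢ e = negS e

idᴬ : Aff
idᴬ = aff 0F plus

_∘ᴬ_ : Aff → Aff → Aff
aff c e ∘ᴬ aff c′ e′ = aff (c ⊕ (e · c′)) (e *ˢ e′)

_⁻¹ᴬ : Aff → Aff
aff c e ⁻¹ᴬ = aff (⊖ (e · c)) e

AffineGroup : RawGroup 0ℓ 0ℓ
AffineGroup = record { Carrier = Aff ; _≈_ = _≡_ ; _∙_ = _∘ᴬ_ ; ε = idᴬ ; _⁻¹ = _⁻¹ᴬ }

-- sgn 0F = plus is a junk value; sgn is only applied to nonzero differences.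
sgn : Z3 → Sign
sgn 2F = minus
sgn _  = plus

fromImages : Z3 → Z3 → Aff
fromImages x y = aff x (sgn (y ⊝ x))

_≟ᴬ_ : (A B : Aff) → Dec (A ≡ B)
aff c e ≟ᴬ aff c′ e′ =
  map′ (λ (p , q) → cong₂ aff p q) (λ { refl → refl , refl }) ((c ≟ c′) ×-dec (e ≟ˢ e′))

∀-Aff? : {P : Aff → Set} → Decidable P → Dec (∀ A → P A)
∀-Aff? P? = map′ (λ h → λ { (aff c e) → h c e }) (λ h c e → h (aff c e))
                 (all? λ c → ∀-Sign? λ e → P? (aff c e))

app-∘ᴬ : ∀ A B x → app (A ∘ᴬ B) x ≡ app A (app B x)
app-∘ᴬ = by-exhaustion (∀-Aff? λ A → ∀-Aff? λ B → all? λ x → _ ≟ _)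

app-inverseˡ : ∀ A x → app (A ⁻¹ᴬ) (app A x) ≡ x
app-inverseˡ = by-exhaustion (∀-Aff? λ A → all? λ x → _ ≟ _)

app-inverseʳ : ∀ A x → app A (app (A ⁻¹ᴬ) x) ≡ x
app-inverseʳ = by-exhaustion (∀-Aff? λ A → all? λ x → _ ≟ _)

app-injective : ∀ A {x y} → app A x ≡ app A y → x ≡ y
app-injective A {x} {y} eq = begin
  x                     ≡⟨ app-inverseˡ A x ⟨
  app (A ⁻¹ᴬ) (app A x) ≡⟨ cong (app (A ⁻¹ᴬ)) eq ⟩
  app (A ⁻¹ᴬ) (app A y) ≡⟨ app-inverseˡ A y ⟩
  y                     ∎
  where open ≡-Reasoning

app-⊕ : ∀ A c d → app A (c ⊕ d) ≡ app A c ⊕ (sign A · d)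
app-⊕ = by-exhaustion (∀-Aff? λ A → all? λ c → all? λ d → _ ≟ _)

app-newLetter : ∀ A a x₁ x₂ xₙ →
  app A (newLetter a x₁ x₂ xₙ) ≡ newLetter a (app A x₁) (app A x₂) (app A xₙ)
app-newLetter = by-exhaustion
  (∀-Aff? λ A → ∀-Sign? λ a → all? λ x₁ → all? λ x₂ → all? λ xₙ → _ ≟ _)

fromImages-app : ∀ A → fromImages (app A 0F) (app A 1F) ≡ A
fromImages-app = by-exhaustion (∀-Aff? λ A → _ ≟ᴬ A)

app-fromImages : ∀ x y z → x ≢ y → y ≢ z → x ≢ z →
  ∀ i → app (fromImages x y) i ≡ lookup (x ∷ y ∷ z ∷ []) i
app-fromImages = by-exhaustion
  (all? λ x → all? λ y → all? λ z →
    ¬? (x ≟ y) →-dec ¬? (y ≟ z) →-dec ¬? (x ≟ z) →-dec all? λ i → _ ≟ _)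

fromImages-0 : ∀ x y → app (fromImages x y) 0F ≡ x
fromImages-0 = by-exhaustion (all? λ x → all? λ y → _ ≟ x)

fromImages-sign : ∀ x y → x ≢ y → sign (fromImages x y) · 1F ≡ y ⊝ x
fromImages-sign = by-exhaustion (all? λ x → all? λ y → ¬? (x ≟ y) →-dec (_ ≟ _))

toPerm : Aff → Permutation′ 3
toPerm A = permutation (app A) (app (A ⁻¹ᴬ)) (app-inverseʳ A) (app-inverseˡ A)

permutation-injective : ∀ (π : Permutation′ 3) {i j} → π ⟨$⟩ʳ i ≡ π ⟨$⟩ʳ j → i ≡ j
permutation-injective π eq = trans (sym (inverseˡ π)) (trans (cong (π ⟨$⟩ˡ_) eq) (inverseˡ π))

toPerm-isGroupIsomorphism : GroupMorphisms.IsGroupIsomorphism AffineGroup D3 toPerm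
toPerm-isGroupIsomorphism = record
  { isGroupMonomorphism = record
    { isGroupHomomorphism = record
      { isMonoidHomomorphism = record
        { isMagmaHomomorphism = record
          { isRelHomomorphism = record { cong = λ { refl i → refl } }
          ; homo = app-∘ᴬ }
        ; ε-homo = λ i → refl }
      ; ⁻¹-homo = λ A i → refl }
    ; injective = injective }
  ; surjective = surjective }
  where
  injective : ∀ {A B} → (∀ i → app A i ≡ app B i) → A ≡ B
  injective {A} {B} A≗B = begin
    A                                ≡⟨ fromImages-app A ⟨
    fromImages (app A 0F) (app A 1F) ≡⟨ cong₂ fromImages (A≗B 0F) (A≗B 1F) ⟩
    fromImages (app B 0F) (app B 1F) ≡⟨ fromImages-app B ⟩
    B                                ∎
    where open ≡-Reasoning

  surjective : ∀ π → ∃ λ A → ∀ {B} → B ≡ A → ∀ i → app B i ≡ π ⟨$⟩ʳ i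
  surjective π = fromImages (π′ 0F) (π′ 1F) , λ { refl i → trans
      (app-fromImages _ _ (π′ 2F) (distinct λ ()) (distinct λ ()) (distinct λ ()) i)
      (lookup∘tabulate π′ i) }
    where
    π′ = π ⟨$⟩ʳ_
    distinct : ∀ {i j} → i ≢ j → π′ i ≢ π′ j
    distinct i≢j = i≢j ∘ permutation-injective π

T-irrelevant : ∀ {b} (p q : T b) → p ≡ q
T-irrelevant {true} _ _ = refl

adjDistinct-irrelevant : ∀ {n} (x : Vec Z3 n) (p q : AdjDistinct x) → p ≡ q
adjDistinct-irrelevant []          _ _ = refl
adjDistinct-irrelevant (x ∷ [])    _ _ = refl
adjDistinct-irrelevant (x ∷ y ∷ r) (p , p′) (q , q′) =
  cong₂ _,_ (T-irrelevant p q) (adjDistinct-irrelevant (y ∷ r) p′ q′)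

vertex-≡ : ∀ {n} {u v : Vertex n} → proj₁ u ≡ proj₁ v → u ≡ v
vertex-≡ {u = ℓ , p} {.ℓ , q} refl = cong (ℓ ,_) (adjDistinct-irrelevant _ p q)

adjDistinct-∷ : ∀ {k y} {x : Vec Z3 (suc k)} →
  y ≢ head x → AdjDistinct x → AdjDistinct (y ∷ x)
adjDistinct-∷ {x = _ ∷ _} y≢x₁ p = fromWitnessFalse y≢x₁ , p

adjDistinct-uncons : ∀ {k y} {x : Vec Z3 (suc k)} →
  AdjDistinct (y ∷ x) → y ≢ head x × AdjDistinct x
adjDistinct-uncons {x = _ ∷ _} (p , q) = toWitnessFalse p , q

arc⇒next : ∀ {m} {ℓ ℓ′ : Label (suc (suc m))} → ArcTarget ℓ ℓ′ → ℓ′ ≡ next ℓ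
arc⇒next {ℓ = _ , _ ∷ _ ∷ _} eq = eq

next-injective : ∀ {m} (ℓ₁ ℓ₂ : Label (suc (suc m))) → next ℓ₁ ≡ next ℓ₂ → ℓ₁ ≡ ℓ₂
next-injective (a , x₁ ∷ x₂ ∷ r) (b , y₁ ∷ y₂ ∷ s) eq
  with refl ← cong proj₁ eq
  with refl , newLetter≡ ← ∷ʳ-injective (x₂ ∷ r) (y₂ ∷ s) (cong proj₂ eq)
  = cong (λ z → a , z ∷ x₂ ∷ r) (newLetter-injective a x₁ y₁ x₂ (last (x₂ ∷ r)) newLetter≡)

arc-injective : ∀ {m} {u u′ w : Vertex (suc (suc m))} → Arc u w → Arc u′ w → u ≡ u′
arc-injective {u = ℓ , _} {ℓ′ , _} uw u′w =
  vertex-≡ (next-injective ℓ ℓ′ (trans (sym (arc⇒next uw)) (arc⇒next u′w)))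

negS-injective : ∀ {a b} → negS a ≡ negS b → a ≡ b
negS-injective {plus}  {plus}  _ = refl
negS-injective {minus} {minus} _ = refl

edge-injective : ∀ {n} {u u′ w : Vertex n} → Edge u w → Edge u′ w → u ≡ u′
edge-injective {u = (a , _) , _} {(a′ , _) , _} (a≡ , x≡) (a′≡ , x′≡) =
  vertex-≡ (cong₂ _,_ (negS-injective (trans (sym a≡) a′≡)) (trans (sym x≡) x′≡))

map-adjDistinct : ∀ (h : Z3 → Z3) → (∀ {x y} → h x ≡ h y → x ≡ y) →
  ∀ {n} (x : Vec Z3 n) → AdjDistinct x → AdjDistinct (map h x)
map-adjDistinct h inj []          _       = tt
map-adjDistinct h inj (x ∷ [])    _       = tt
map-adjDistinct h inj (x ∷ y ∷ r) (p , q) =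
  fromWitnessFalse (toWitnessFalse p ∘ inj) , map-adjDistinct h inj (y ∷ r) q

last-map : ∀ {A B : Set} (h : A → B) {k} (x : Vec A (suc k)) → last (map h x) ≡ h (last x)
last-map h (x ∷ [])    = refl
last-map h (x ∷ y ∷ r) = last-map h (y ∷ r)

relabel : ∀ {n} → Aff → Vertex n → Vertex n
relabel A ((a , x) , p) = (a , map (app A) x) , map-adjDistinct (app A) (app-injective A) x p

relabel-∘ᴬ : ∀ {n} A B (v : Vertex n) → relabel (A ∘ᴬ B) v ≡ relabel A (relabel B v)
relabel-∘ᴬ A B ((a , x) , _) =
  vertex-≡ (cong (a ,_) (trans (map-cong (app-∘ᴬ A B) x) (map-∘ (app A) (app B) x)))

relabel-cancel : ∀ {n} A B → (∀ x → app A (app B x) ≡ x) →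
  ∀ (v : Vertex n) → relabel A (relabel B v) ≡ v
relabel-cancel A B A∘B≗id ((a , x) , _) = vertex-≡ (cong (a ,_) (begin
  map (app A) (map (app B) x) ≡⟨ map-∘ (app A) (app B) x ⟨
  map (app A ∘ app B) x       ≡⟨ map-cong A∘B≗id x ⟩
  map (λ y → y) x             ≡⟨ map-id x ⟩
  x                           ∎))
  where open ≡-Reasoning

relabel-edge : ∀ {n} A {u v : Vertex n} → Edge u v → Edge (relabel A u) (relabel A v)
relabel-edge A {(_ , _) , _} {(_ , _) , _} (b≡ , y≡) = b≡ , cong (map (app A)) y≡

relabel-arc : ∀ {n} A {u v : Vertex n} → Arc u v → Arc (relabel A u) (relabel A v)
relabel-arc A {(a , [])          , _} ()
relabel-arc A {(a , _ ∷ [])      , _} ()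
relabel-arc A {(a , x₁ ∷ x₂ ∷ r) , _} {_ , _} refl = cong (a ,_) (begin
  map h (w ∷ʳ newLetter a x₁ x₂ (last w))
    ≡⟨ map-∷ʳ h _ w ⟩
  map h w ∷ʳ h (newLetter a x₁ x₂ (last w))
    ≡⟨ cong (map h w ∷ʳ_) (app-newLetter A a x₁ x₂ (last w)) ⟩
  map h w ∷ʳ newLetter a (h x₁) (h x₂) (h (last w))
    ≡⟨ cong (λ z → map h w ∷ʳ newLetter a (h x₁) (h x₂) z) (last-map h w) ⟨
  map h w ∷ʳ newLetter a (h x₁) (h x₂) (last (map h w)) ∎)
  where
  h = app A
  w = x₂ ∷ r
  open ≡-Reasoning

relabelAut : ∀ {n} → Aff → Aut n
relabelAut A = record
  { to        = relabel A
  ; from      = relabel (A ⁻¹ᴬ)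
  ; from∘to   = relabel-cancel (A ⁻¹ᴬ) A (app-inverseˡ A)
  ; to∘from   = relabel-cancel A (A ⁻¹ᴬ) (app-inverseʳ A)
  ; to-edge   = λ {u v} → relabel-edge A {u} {v}
  ; from-edge = λ {u v} → relabel-edge (A ⁻¹ᴬ) {u} {v}
  ; to-arc    = λ {u v} → relabel-arc A {u} {v}
  ; from-arc  = λ {u v} → relabel-arc (A ⁻¹ᴬ) {u} {v} }

-- Rigidity

prependAll : ∀ {A : Set} {k n} → Vec A k → Vec A (suc n) → Vec A (suc n)
prependAll []      u = u
prependAll (y ∷ w) u = y ∷ init (prependAll w u)

init-prependAll : ∀ {A : Set} {k n} (w : Vec A k) (u : Vec A (suc (suc n))) →
  init (prependAll w u) ≡ prependAll w (init u)
init-prependAll []      u = refl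
init-prependAll (y ∷ w) u = cong (λ z → y ∷ init z) (init-prependAll w u)

prependAll-self : ∀ {A : Set} {n} (w u : Vec A (suc n)) → prependAll w u ≡ w
prependAll-self {n = zero}  (y ∷ []) (_ ∷ []) = refl
prependAll-self {n = suc n} (y ∷ w)  u        =
  cong (y ∷_) (trans (init-prependAll w u) (prependAll-self w (init u)))

head-init : ∀ {A : Set} {k} (x : Vec A (suc (suc k))) → head (init x) ≡ head x
head-init (x₁ ∷ x₂ ∷ r) = refl

init-∷ʳ-last : ∀ {A : Set} {k} (x : Vec A (suc k)) → init x ∷ʳ last x ≡ x
init-∷ʳ-last x = sym (proj₂ (proj₂ (initLast x)))

init-adjDistinct : ∀ {k} (x : Vec Z3 (suc k)) → AdjDistinct x → AdjDistinct (init x)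
init-adjDistinct (x₁ ∷ [])          _       = tt
init-adjDistinct (x₁ ∷ x₂ ∷ [])     _       = tt
init-adjDistinct (x₁ ∷ x₂ ∷ x₃ ∷ r) (p , q) = p , init-adjDistinct (x₂ ∷ x₃ ∷ r) q

last-init≢last : ∀ {k} (x : Vec Z3 (suc (suc k))) → AdjDistinct x → last (init x) ≢ last x
last-init≢last (x₁ ∷ x₂ ∷ [])     (p , _) = toWitnessFalse p
last-init≢last (x₁ ∷ x₂ ∷ x₃ ∷ r) (_ , q) = last-init≢last (x₂ ∷ x₃ ∷ r) q

prepend-adjDistinct : ∀ {k y} (u : Vec Z3 (suc (suc k))) →
  y ≢ head u → AdjDistinct u → AdjDistinct (y ∷ init u)
prepend-adjDistinct {y = y} u y≢u₁ p =
  adjDistinct-∷ (subst (y ≢_) (sym (head-init u)) y≢u₁) (init-adjDistinct u p)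

prependAll-adjDistinct : ∀ {k n} (w : Vec Z3 k) (u : Vec Z3 (suc (suc n))) →
  AdjDistinct (w ++ u) → AdjDistinct (prependAll w u)
prependAll-adjDistinct []           u p        = p
prependAll-adjDistinct (y ∷ [])     u p        =
  prepend-adjDistinct u (proj₁ (adjDistinct-uncons p)) (proj₂ (adjDistinct-uncons p))
prependAll-adjDistinct (y ∷ y′ ∷ w) u (p , p′) =
  prepend-adjDistinct (prependAll (y′ ∷ w) u) (toWitnessFalse p)
                      (prependAll-adjDistinct (y′ ∷ w) u p′)

++-adjDistinct : ∀ {k n} (w : Vec Z3 (suc k)) {u : Vec Z3 (suc n)} →
  AdjDistinct w → AdjDistinct u → last w ≢ head u → AdjDistinct (w ++ u)
++-adjDistinct (y ∷ [])     _        q wₙ≢u₁ = adjDistinct-∷ wₙ≢u₁ q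
++-adjDistinct (y ∷ y′ ∷ w) (p , p′) q wₙ≢u₁ = p , ++-adjDistinct (y′ ∷ w) p′ q wₙ≢u₁

avoid : ∀ x y → ∃ λ (z : Z3) → z ≢ x × z ≢ y
avoid = by-exhaustion (all? λ x → all? λ y → any? λ z → ¬? (z ≟ x) ×-dec ¬? (z ≟ y))

arc-prepend : ∀ {m c y} (z : Vec Z3 (suc (suc m))) →
  last z ≡ newLetter c y (head z) (last (init z)) → ArcTarget (c , y ∷ init z) (c , z)
arc-prepend {c = c} z@(_ ∷ _ ∷ _) eq =
  cong (c ,_) (trans (sym (init-∷ʳ-last z)) (cong (init z ∷ʳ_) eq))

module _ {m : ℕ} (f g : Aut (suc (suc m))) where

  Agree : Vertex (suc (suc m)) → Set
  Agree v = to f v ≡ to g v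

  AgreeOn : Vec Z3 (suc (suc m)) → Set
  AgreeOn x = ∀ a p → Agree ((a , x) , p)

  agree-arc⁻ : ∀ {u v} → Arc u v → Agree v → Agree u
  agree-arc⁻ {u} {v} uv fv≡gv =
    arc-injective {u = to f u} {to g u} {to g v}
      (subst (Arc (to f u)) fv≡gv (to-arc f {u} {v} uv)) (to-arc g {u} {v} uv)

  agree-edge⁻ : ∀ {u v} → Edge u v → Agree v → Agree u
  agree-edge⁻ {u} {v} uv fv≡gv =
    edge-injective {u = to f u} {to g u} {to g v}
      (subst (Edge (to f u)) fv≡gv (to-edge f {u} {v} uv)) (to-edge g {u} {v} uv)

  agree-irrelevant : ∀ {ℓ p q} → Agree (ℓ , p) → Agree (ℓ , q)
  agree-irrelevant {ℓ} {p} {q} = subst Agree (vertex-≡ {u = ℓ , p} {ℓ , q} refl)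

  agree-signs : ∀ {a x p} → Agree ((a , x) , p) → AgreeOn x
  agree-signs {plus}  h plus  q = agree-irrelevant h
  agree-signs {minus} h minus q = agree-irrelevant h
  agree-signs {plus}  {x} h minus q =
    agree-edge⁻ {v = (plus , x) , q} (refl , refl) (agree-irrelevant h)
  agree-signs {minus} {x} h plus  q =
    agree-edge⁻ {v = (minus , x) , q} (refl , refl) (agree-irrelevant h)

  -- Of the two letters other than last (init z), each is appended by the arc
  -- rule for exactly one sign; for the opposite sign, detour through the edge.
  agree-prepend : ∀ {y} (z : Vec Z3 (suc (suc m))) →
    AdjDistinct z → y ≢ head z → AgreeOn z → AgreeOn (y ∷ init z)
  agree-prepend {y} z@(_ ∷ _ ∷ _) vz y≢z₁ agree b p
    with newLetter-either b y (head z) (last (init z)) (last z) y≢z₁ (last-init≢last z vz ∘ sym)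
  ... | inj₁ eq = agree-arc⁻ (arc-prepend z eq) (agree b vz)
  ... | inj₂ eq = agree-edge⁻ {v = (negS b , y ∷ init z) , p} (refl , refl)
                    (agree-arc⁻ (arc-prepend z eq) (agree (negS b) vz))

  agree-prependAll : ∀ {k} (w : Vec Z3 k) (u : Vec Z3 (suc (suc m))) →
    AdjDistinct (w ++ u) → AgreeOn u → AgreeOn (prependAll w u)
  agree-prependAll []           u _        agree = agree
  agree-prependAll (y ∷ [])     u p        agree =
    agree-prepend u (proj₂ (adjDistinct-uncons p)) (proj₁ (adjDistinct-uncons p)) agree
  agree-prependAll (y ∷ y′ ∷ w) u (p , p′) agree =
    agree-prepend (prependAll (y′ ∷ w) u) (prependAll-adjDistinct (y′ ∷ w) u p′)
      (toWitnessFalse p) (agree-prependAll (y′ ∷ w) u p′ agree)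

  -- A first letter y avoiding both head u and last w lets w be prepended to y ∷ init u.
  agree-everywhere : ∀ {v} → Agree v → ∀ w → Agree w
  agree-everywhere {(a , u) , p} h ((b , w) , q)
    with y , y≢u₁ , y≢wₙ ← avoid (head u) (last w) =
    subst AgreeOn (prependAll-self w (y ∷ init u)) agree-w b q
    where
    agree-w : AgreeOn (prependAll w (y ∷ init u))
    agree-w = agree-prependAll w (y ∷ init u)
      (++-adjDistinct w q (prepend-adjDistinct u y≢u₁ p) (y≢wₙ ∘ sym))
      (agree-prepend u p y≢u₁ (agree-signs h))

-- Directed triangles

ap : Z3 → Z3 → (k : ℕ) → Vec Z3 k
ap c d zero    = []
ap c d (suc k) = c ∷ ap (c ⊕ d) d k

periodic : ∀ {A : Set} → A → A → A → (k : ℕ) → Vec A k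
periodic p q s zero    = []
periodic p q s (suc k) = p ∷ periodic q s p k

rotate : ∀ {A : Set} → ℕ → A × A × A → A × A × A
rotate zero    t           = t
rotate (suc k) (p , q , s) = rotate k (q , s , p)

shift³-periodic : ∀ {A : Set} k (p q s : A) (r : Vec A k) c₁ c₂ c₃ →
  ((r ∷ʳ c₁) ∷ʳ c₂) ∷ʳ c₃ ≡ p ∷ q ∷ s ∷ r →
  r ≡ periodic p q s k × (c₁ , c₂ , c₃) ≡ rotate k (p , q , s)
shift³-periodic zero    p q s []       c₁ c₂ c₃ refl = refl , refl
shift³-periodic (suc k) p q s (r₁ ∷ r) c₁ c₂ c₃ eq
  with refl , eq′ ← ∷-injective eq
  with r≡ , c≡ ← shift³-periodic k q s p r c₁ c₂ c₃ eq′
  = cong (p ∷_) r≡ , c≡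

Progression₃ : Z3 → Z3 → Z3 → Z3 → Set
Progression₃ d p q s = q ≡ p ⊕ d × s ≡ q ⊕ d × p ≡ s ⊕ d

periodic-ap : ∀ {d p q s} k → Progression₃ d p q s → periodic p q s k ≡ ap p d k
periodic-ap         zero    _              = refl
periodic-ap {d} {p} (suc k) (q≡ , s≡ , p≡) =
  cong (p ∷_) (trans (periodic-ap k (s≡ , p≡ , q≡)) (cong (λ c → ap c d k) q≡))

-- If three arcs out of a|p q s … append t₁ t₂ t₃ and return to a|p q s …, then
-- its fourth letter is p and its last letter is t₃, so these equations hold.
Closes : Sign → Z3 × Z3 × Z3 → Z3 × Z3 × Z3 → Set
Closes a (p , q , s) (t₁ , t₂ , t₃) =
  t₁ ≡ newLetter a p q t₃ × t₂ ≡ newLetter a q s t₁ × t₃ ≡ newLetter a s p t₂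

closes? : ∀ a p q s t₁ t₂ t₃ → Dec (Closes a (p , q , s) (t₁ , t₂ , t₃))
closes? a p q s t₁ t₂ t₃ = (t₁ ≟ _) ×-dec (t₂ ≟ _) ×-dec (t₃ ≟ _)

closes-rotate⇒progression-small : ∀ (j : Fin 3) a p q s →
  AdjDistinct (periodic p q s (3 + toℕ j)) → Closes a (p , q , s) (rotate (toℕ j) (p , q , s)) →
  a ≡ plus × Progression₃ (q ⊝ p) p q s
closes-rotate⇒progression-small = by-exhaustion
  (all? λ j → ∀-Sign? λ a → all? λ p → all? λ q → all? λ s →
    adjDistinct? (periodic p q s (3 + toℕ j)) →-dec closes? a p q s _ _ _ →-dec
    ((a ≟ˢ plus) ×-dec (q ≟ _) ×-dec (s ≟ _) ×-dec (p ≟ _)))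

closes-rotate⇒progression : ∀ k {a p q s} →
  AdjDistinct (periodic p q s (3 + k)) → Closes a (p , q , s) (rotate k (p , q , s)) →
  a ≡ plus × Progression₃ (q ⊝ p) p q s
closes-rotate⇒progression 0 = closes-rotate⇒progression-small 0F _ _ _ _
closes-rotate⇒progression 1 = closes-rotate⇒progression-small 1F _ _ _ _
closes-rotate⇒progression 2 = closes-rotate⇒progression-small 2F _ _ _ _
closes-rotate⇒progression (suc (suc (suc k))) (_ , _ , _ , p) = closes-rotate⇒progression k p

next³-fixed₂ : ∀ a p q → p ≢ q → next (next (next (a , p ∷ q ∷ []))) ≡ (a , p ∷ q ∷ []) →
  a ≡ plus × q ≡ p ⊕ (q ⊝ p)
next³-fixed₂ = by-exhaustion
  (∀-Sign? λ a → all? λ p → all? λ q →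
    ¬? (p ≟ q) →-dec label? _ _ →-dec ((a ≟ˢ plus) ×-dec (q ≟ _)))

head-∷ʳ : ∀ {A : Set} {k} (w : Vec A (suc k)) x → head (w ∷ʳ x) ≡ head w
head-∷ʳ (_ ∷ _) x = refl

next-∷ : ∀ {k} a s (w : Vec Z3 (suc k)) →
  next (a , s ∷ w) ≡ (a , w ∷ʳ newLetter a s (head w) (last w))
next-∷ a s (_ ∷ _) = refl

next³-fixed⇒progression : ∀ {m} a p q (r : Vec Z3 m) → AdjDistinct (p ∷ q ∷ r) →
  next (next (next (a , p ∷ q ∷ r))) ≡ (a , p ∷ q ∷ r) →
  a ≡ plus × p ∷ q ∷ r ≡ ap p (q ⊝ p) (suc (suc m))
next³-fixed⇒progression a p q [] (p≢q , _) cycle =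
  proj₁ result , cong (λ z → p ∷ z ∷ []) (proj₂ result)
  where result = next³-fixed₂ a p q (toWitnessFalse p≢q) cycle
next³-fixed⇒progression {suc k} a p q (s ∷ r) valid cycle =
  proj₁ result , trans (cong (λ z → p ∷ q ∷ s ∷ z) r≡) (periodic-ap (3 + k) (proj₂ result))
  where
  open ≡-Reasoning
  c₁ = newLetter a p q (last (s ∷ r))
  c₂ = newLetter a q s c₁
  W  = (r ∷ʳ c₁) ∷ʳ c₂
  c₃ = newLetter a s (head W) c₂

  next³ : next (next (next (a , p ∷ q ∷ s ∷ r))) ≡ (a , W ∷ʳ c₃)
  next³ = begin
    next (a , s ∷ ((r ∷ʳ c₁) ∷ʳ newLetter a q s (last ((s ∷ r) ∷ʳ c₁))))
      ≡⟨ cong (λ z → next (a , s ∷ ((r ∷ʳ c₁) ∷ʳ newLetter a q s z))) (last-∷ʳ c₁ (s ∷ r)) ⟩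
    next (a , s ∷ W)
      ≡⟨ next-∷ a s W ⟩
    (a , W ∷ʳ newLetter a s (head W) (last W))
      ≡⟨ cong (λ z → a , W ∷ʳ newLetter a s (head W) z) (last-∷ʳ c₂ (r ∷ʳ c₁)) ⟩
    (a , W ∷ʳ c₃) ∎

  shifted : W ∷ʳ c₃ ≡ p ∷ q ∷ s ∷ r
  shifted = cong proj₂ (trans (sym next³) cycle)

  closes : Closes a (p , q , s) (c₁ , c₂ , c₃)
  closes = cong (newLetter a p q) (trans (cong last (sym shifted)) (last-∷ʳ c₃ W))
         , refl
         , cong (λ z → newLetter a s z c₂) (trans (sym (head-∷ʳ W c₃)) (cong head shifted))

  periodicity = shift³-periodic k p q s r c₁ c₂ c₃ shifted
  r≡ = proj₁ periodicity
  result = closes-rotate⇒progression k (subst (λ z → AdjDistinct (p ∷ q ∷ s ∷ z)) r≡ valid)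
                                       (subst (Closes a (p , q , s)) (proj₂ periodicity) closes)

ap-adjDistinct : ∀ c {d} k → d ≢ 0F → AdjDistinct (ap c d k)
ap-adjDistinct c zero          d≢0 = tt
ap-adjDistinct c (suc zero)    d≢0 = tt
ap-adjDistinct c (suc (suc k)) d≢0 =
  fromWitnessFalse (⊕-nonzero c _ d≢0) , ap-adjDistinct (c ⊕ _) (suc k) d≢0
  where
  ⊕-nonzero : ∀ c d → d ≢ 0F → c ≢ c ⊕ d
  ⊕-nonzero = by-exhaustion (all? λ c → all? λ d → ¬? (d ≟ 0F) →-dec ¬? (c ≟ _))

ap-∷ʳ : ∀ c d k → ap c d (suc k) ∷ʳ (last (ap c d (suc k)) ⊕ d) ≡ c ∷ ap (c ⊕ d) d (suc k)
ap-∷ʳ c d zero    = refl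
ap-∷ʳ c d (suc k) = cong (c ∷_) (ap-∷ʳ (c ⊕ d) d k)

map-ap : ∀ A c d k → map (app A) (ap c d k) ≡ ap (app A c) (sign A · d) k
map-ap A c d zero    = refl
map-ap A c d (suc k) = cong (app A c ∷_) (begin
  map (app A) (ap (c ⊕ d) d k)       ≡⟨ map-ap A (c ⊕ d) d k ⟩
  ap (app A (c ⊕ d)) (sign A · d) k  ≡⟨ cong (λ z → ap z (sign A · d) k) (app-⊕ A c d) ⟩
  ap (app A c ⊕ (sign A · d)) (sign A · d) k ∎)
  where open ≡-Reasoning

-- Aut(F*(n)) ≅ AGL(1, 3)

module _ {m : ℕ} where

  progression : Z3 → Vertex (suc (suc m))
  progression c = (plus , ap c 1F _) , ap-adjDistinct c _ λ ()

  base : Vertex (suc (suc m))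
  base = progression 0F

  affAt : Vertex (suc (suc m)) → Aff
  affAt ((_ , x₁ ∷ x₂ ∷ _) , _) = fromImages x₁ x₂

  triangle⇒relabel-base : ∀ (u v w : Vertex (suc (suc m))) → Arc u v → Arc v w → Arc w u →
    u ≡ relabel (affAt u) base
  triangle⇒relabel-base u@((a , x₁ ∷ x₂ ∷ r) , valid) _ _ uv vw wu =
    vertex-≡ (cong₂ _,_ (proj₁ result) word≡)
    where
    open ≡-Reasoning
    cycle : next (next (next (a , x₁ ∷ x₂ ∷ r))) ≡ (a , x₁ ∷ x₂ ∷ r)
    cycle = sym (trans (arc⇒next wu) (cong next (trans (arc⇒next vw) (cong next (arc⇒next uv)))))
    result = next³-fixed⇒progression a x₁ x₂ r valid cycle
    A = affAt u
    word≡ : x₁ ∷ x₂ ∷ r ≡ map (app A) (ap 0F 1F _)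
    word≡ = begin
      x₁ ∷ x₂ ∷ r                   ≡⟨ proj₂ result ⟩
      ap x₁ (x₂ ⊝ x₁) _             ≡⟨ cong₂ (λ c d → ap c d _) (fromImages-0 x₁ x₂)
                                        (fromImages-sign x₁ x₂ (toWitnessFalse (proj₁ valid))) ⟨
      ap (app A 0F) (sign A · 1F) _ ≡⟨ map-ap A 0F 1F _ ⟨
      map (app A) (ap 0F 1F _)      ∎

  affOf : Aut (suc (suc m)) → Aff
  affOf f = affAt (to f base)

  aut≈relabel : ∀ (f : Aut (suc (suc m))) → f ≈A relabelAut (affOf f)
  aut≈relabel f = agree-everywhere f (relabelAut (affOf f)) {base}
    (triangle⇒relabel-base (to f base) (to f (progression 1F)) (to f (progression 2F))
      (to-arc f {base} {progression 1F} arc₀₁)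
      (to-arc f {progression 1F} {progression 2F} arc₁₂)
      (to-arc f {progression 2F} {base} arc₂₀))
    where
    arc₀₁ : Arc base (progression 1F)
    arc₀₁ = cong (plus ,_) (sym (ap-∷ʳ 1F 1F m))
    arc₁₂ : Arc (progression 1F) (progression 2F)
    arc₁₂ = cong (plus ,_) (sym (ap-∷ʳ 2F 1F m))
    arc₂₀ : Arc (progression 2F) base
    arc₂₀ = cong (plus ,_) (sym (ap-∷ʳ 0F 1F m))

  affOf-cong : ∀ {f g : Aut (suc (suc m))} → f ≈A g → affOf f ≡ affOf g
  affOf-cong f≈g = cong affAt (f≈g base)

  affOf-relabel : ∀ A → affOf (relabelAut A) ≡ A
  affOf-relabel = fromImages-app

  affOf-isGroupIsomorphism :
    GroupMorphisms.IsGroupIsomorphism (AutGroup (suc (suc m))) AffineGroup affOf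
  affOf-isGroupIsomorphism = record
    { isGroupMonomorphism = record
      { isGroupHomomorphism = record
        { isMonoidHomomorphism = record
          { isMagmaHomomorphism = record
            { isRelHomomorphism = record { cong = λ {f g} → affOf-cong {f} {g} }
            ; homo = homo }
          ; ε-homo = refl }
        ; ⁻¹-homo = inverse-homo }
      ; injective = λ {f} {g} A≡B v → trans (aut≈relabel f v)
          (trans (cong (λ A → relabel A v) A≡B) (sym (aut≈relabel g v))) }
    ; surjective = λ A → relabelAut A ,
        λ {z} z≈ → trans (affOf-cong {z} {relabelAut A} z≈) (affOf-relabel A) }
    where
    open ≡-Reasoning

    homo : ∀ f g → affOf (f ∘A g) ≡ affOf f ∘ᴬ affOf g
    homo f g = begin
      affOf (f ∘A g)
        ≡⟨ affOf-cong {f ∘A g} {relabelAut A ∘A relabelAut B}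
             (λ v → trans (cong (to f) (aut≈relabel g v)) (aut≈relabel f _)) ⟩
      affOf (relabelAut A ∘A relabelAut B)
        ≡⟨ affOf-cong {relabelAut (A ∘ᴬ B)} {relabelAut A ∘A relabelAut B} (relabel-∘ᴬ A B) ⟨
      affOf (relabelAut (A ∘ᴬ B))
        ≡⟨ affOf-relabel (A ∘ᴬ B) ⟩
      A ∘ᴬ B ∎
      where
      A = affOf f
      B = affOf g

    inverse-homo : ∀ f → affOf (invAut f) ≡ affOf f ⁻¹ᴬ
    inverse-homo f =
      trans (affOf-cong {invAut f} {relabelAut (A ⁻¹ᴬ)} from≈) (affOf-relabel (A ⁻¹ᴬ))
      where
      A = affOf f
      from≈ : ∀ v → from f v ≡ relabel (A ⁻¹ᴬ) v
      from≈ v = begin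
        from f v
          ≡⟨ cong (from f) (relabel-cancel A (A ⁻¹ᴬ) (app-inverseʳ A) v) ⟨
        from f (relabel A (relabel (A ⁻¹ᴬ) v))
          ≡⟨ cong (from f) (aut≈relabel f _) ⟨
        from f (to f (relabel (A ⁻¹ᴬ) v))
          ≡⟨ from∘to f _ ⟩
        relabel (A ⁻¹ᴬ) v ∎

mainTheorem2 : ∀ (n : ℕ) → 2 ≤ n →
    Σ (RawGroup.Carrier (AutGroup n) → RawGroup.Carrier D3)
      (λ φ → GroupMorphisms.IsGroupIsomorphism (AutGroup n) D3 φ)
mainTheorem2 (suc (suc m)) (s≤s (s≤s z≤n)) =
  toPerm ∘ affOf ,
  isGroupIsomorphism (λ p q i → trans (p i) (q i))
                     affOf-isGroupIsomorphism toPerm-isGroupIsomorphism
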